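{- Let $n,k$ be positive integers. For every $\pi\in\mathcal P_n^k$, $$\mathrm{mak}(\pi)=\mathrm{lmak}'(\pi),\qquad \mathrm{mak}'(\pi)=\mathrm{lmak}(\pi).$$
   Context: $\mathcal P_n^k$ denotes the set of set partitions of $[n]$ into $k$ blocks, written $\pi=B_1-\cdots-B_k$ with the blocks listed in increasing order of their smallest elements. Let $w_i$ be the index of the block containing $i$. The openers $\mathcal O(\pi)$ are the smallest elements of the blocks, and the closers $\mathcal F(\pi)$ are their largest elements. For $i\in[n]$ define: $\mathrm{ros}_i=\#\{j\in\mathcal O: j<i,\ w_j>w_i\}$, $\mathrm{rob}_i=\#\{j\in\mathcal O: j>i,\ w_j>w_i\}$, $\mathrm{rcs}_i=\#\{j\in\mathcal F: j<i,\ w_j>w_i\}$, $\mathrm{rcb}_i=\#\{j\in\mathcal F: j>i,\ w_j>w_i\}$, $\mathrm{los}_i=\#\{j\in\mathcal O: j<i,\ w_j<w_i\}$, $\mathrm{lob}_i=\#\{j\in\mathcal O: j>i,\ w_j<w_i\}$, $\mathrm{lcs}_i=\#\{j\in\mathcal F: j<i,\ w_j<w_i\}$, $\mathrm{lcb}_i=\#\{j\in\mathcal F: j>i,\ w_j<w_i\}$. Each statistic is the sum of its coordinates over $i\in[n]$. Define $\mathrm{mak}=\mathrm{ros}+\mathrm{lcs}$, $\mathrm{mak}'=\mathrm{lob}+\mathrm{rcb}$, $\mathrm{lmak}'=n(k-1)-(\mathrm{lcb}+\mathrm{rob})$ and $\mathrm{lmak}=n(k-1)-(\mathrm{los}+\mathrm{rcs})$.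 -}

module Defs where

open import Data.Nat using (ℕ; _*_; _∸_)
import Data.Nat as ℕ
open import Data.Fin using (Fin; _<_; _≤_; _<?_; _≤?_)
open import Data.Fin.Properties using (all?; _≟_)
open import Data.List using (List; length; filter)
open import Data.List.Base using (allFin)
open import Data.Product using (Σ; _×_; ∃-syntax)
open import Function.Definitions using (Surjective)
open import Relation.Binary.PropositionalEquality using (_≡_)
open import Relation.Nullary using (Dec; ¬_; yes; no)
open import Relation.Nullary.Decidable using (_×-dec_; ¬?)
open import Relation.Unary using (Pred; Decidable)
open import Data.Integer using (ℤ; +_; _-_)
open import Level using (0ℓ)
open import Data.Nat.ListAction using (sum)

-- A set partition π of [n] = {0,…,n-1} into k blocks B₁-⋯-Bₖ (blocks listed in
-- increasing order of their smallest elements) is encoded by the map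
-- w : Fin n → Fin k, where w i is the (0-based) index of the block containing i.
record SetPartition (n k : ℕ) : Set where
  field
    w         : Fin n → Fin k
    nonempty  : Surjective _≡_ _≡_ w
    ordered   : ∀ (i : Fin n) (b : Fin k) → b < w i → ∃[ j ] (j < i × w j ≡ b)
open SetPartition public

count : ∀ {n} {P : Pred (Fin n) 0ℓ} → Decidable P → ℕ
count {n} P? = length (filter P? (allFin n))

module _ {n k : ℕ} (π : SetPartition n k) where
  private
    v = w π

  IsOpener : Fin n → Set
  IsOpener j = ∀ j' → v j' ≡ v j → j ≤ j'

  isOpener? : Decidable IsOpener
  isOpener? j = all? (λ j' → dimp (v j' ≟ v j) (j ≤? j'))
    where
    dimp : ∀ {A B : Set} → Dec A → Dec B → Dec (A → B)
    dimp (yes a) (yes b) = yes (λ _ → b)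
    dimp (yes a) (no ¬b) = no (λ f → ¬b (f a))
    dimp (no ¬a) _       = yes (λ a → Data.Empty.⊥-elim (¬a a))
      where import Data.Empty

  IsCloser : Fin n → Set
  IsCloser j = ∀ j' → v j' ≡ v j → j' ≤ j

  isCloser? : Decidable IsCloser
  isCloser? j = all? (λ j' → dimp (v j' ≟ v j) (j' ≤? j))
    where
    dimp : ∀ {A B : Set} → Dec A → Dec B → Dec (A → B)
    dimp (yes a) (yes b) = yes (λ _ → b)
    dimp (yes a) (no ¬b) = no (λ f → ¬b (f a))
    dimp (no ¬a) _       = yes (λ a → Data.Empty.⊥-elim (¬a a))
      where import Data.Empty

  ros-i rob-i rcs-i rcb-i los-i lob-i lcs-i lcb-i : Fin n → ℕ
  ros-i i = count (λ j → isOpener? j ×-dec (j <? i) ×-dec (v i <? v j))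
  rob-i i = count (λ j → isOpener? j ×-dec (i <? j) ×-dec (v i <? v j))
  rcs-i i = count (λ j → isCloser? j ×-dec (j <? i) ×-dec (v i <? v j))
  rcb-i i = count (λ j → isCloser? j ×-dec (i <? j) ×-dec (v i <? v j))
  los-i i = count (λ j → isOpener? j ×-dec (j <? i) ×-dec (v j <? v i))
  lob-i i = count (λ j → isOpener? j ×-dec (i <? j) ×-dec (v j <? v i))
  lcs-i i = count (λ j → isCloser? j ×-dec (j <? i) ×-dec (v j <? v i))
  lcb-i i = count (λ j → isCloser? j ×-dec (i <? j) ×-dec (v j <? v i))

  Σᵢ : (Fin n → ℕ) → ℕ
  Σᵢ f = sum (Data.List.map f (allFin n))

  ros rob rcs rcb los lob lcs lcb : ℕ
  ros = Σᵢ ros-i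
  rob = Σᵢ rob-i
  rcs = Σᵢ rcs-i
  rcb = Σᵢ rcb-i
  los = Σᵢ los-i
  lob = Σᵢ lob-i
  lcs = Σᵢ lcs-i
  lcb = Σᵢ lcb-i

  mak mak′ : ℕ
  mak  = ros ℕ.+ lcs
  mak′ = lob ℕ.+ rcb

  -- lmak′ and lmak involve a subtraction; taken in ℤ (no truncation)
  lmak′ lmak : ℤ
  lmak′ = + (n * (k ∸ 1)) - + (lcb ℕ.+ rob)
  lmak  = + (n * (k ∸ 1)) - + (los ℕ.+ rcs)

{-# OPTIONS --safe #-}
-- Fix a position i. An opener j in another block is counted by exactly one of ros_i, rob_i, los_i,
-- lob_i, according to whether j < i or j > i and whether its block lies above or below that of i.
-- Each block has exactly one opener, so ros_i + rob_i is the number of blocks above w_i and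
-- los_i + lob_i the number below; the same holds for closers. There are k - 1 blocks other than
-- w_i, hence ros_i + lcs_i + lcb_i + rob_i = k - 1 = lob_i + rcb_i + los_i + rcs_i, and summing
-- over i gives mak + (lcb + rob) = n(k - 1) = mak′ + (los + rcs).
module Submission where

open import Defs
open import Data.Nat using (ℕ; _≥_)
open import Data.Integer using (+_)
open import Data.Product using (_×_)
open import Relation.Binary.PropositionalEquality using (_≡_)

import Data.Nat.Properties as ℕ
open import Algebra.Properties.CommutativeSemigroup ℕ.+-commutativeSemigroup using (interchange)
open import Algebra.Properties.Semiring.Sum ℕ.+-*-semiring
  using (sum-syntax; sum-cong-≗; sum-replicate-zero; sum-remove; ∑-distrib-+; ∑-comm; *-distribˡ-sum)
open import Data.Bool using (true; false; if_then_else_)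
open import Data.Fin using (Fin; zero; suc; _<_; _≤_; _<?_; punchIn)
open import Data.Fin.Properties using (_≟_; <-cmp; <-irrefl; <-asym; ≤-antisym; punchInᵢ≢i; any?)
import Data.Integer as ℤ
open import Data.Integer.Properties using ([+m]-[+n]≡m⊖n; ⊖-≥)
open import Data.List using (List; []; _∷_; map; filter; length; tabulate)
open import Data.Nat using (zero; suc; _+_; _*_; _∸_; z≤n; s≤s)
import Data.Nat.ListAction as List
open import Data.Product using (_,_; ∃; ∃!; proj₁; proj₂)
open import Level using (0ℓ)
open import Function using (_∘_; id)
open import Relation.Binary using (tri<; tri≈; tri>)
open import Relation.Binary.PropositionalEquality using (_≢_; refl; sym; trans; cong; cong₂; module ≡-Reasoning)
open import Relation.Nullary using (Dec; does; _because_; yes; no; ¬_)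
open import Relation.Nullary.Decidable using (_×-dec_; dec-true; dec-false)
open import Relation.Nullary.Negation using (contradiction)
open import Relation.Unary using (Pred; Decidable)

open ≡-Reasoning

𝟙 : {A : Set} → Dec A → ℕ
𝟙 a? = if does a? then 1 else 0

𝟙-true : {A : Set} (a? : Dec A) → A → 𝟙 a? ≡ 1
𝟙-true a? a = cong (λ b → if b then 1 else 0) (dec-true a? a)

𝟙-false : {A : Set} (a? : Dec A) → ¬ A → 𝟙 a? ≡ 0
𝟙-false a? ¬a = cong (λ b → if b then 1 else 0) (dec-false a? ¬a)

𝟙-×-dec : {A B : Set} (a? : Dec A) (b? : Dec B) → 𝟙 (a? ×-dec b?) ≡ 𝟙 a? * 𝟙 b?
𝟙-×-dec (true because _)  b? = sym (ℕ.+-identityʳ (𝟙 b?))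
𝟙-×-dec (false because _) b? = refl

length-filter≡sum-𝟙 : {A : Set} {P : Pred A 0ℓ} (P? : Decidable P) (xs : List A) →
  length (filter P? xs) ≡ List.sum (map (𝟙 ∘ P?) xs)
length-filter≡sum-𝟙 P? [] = refl
length-filter≡sum-𝟙 P? (x ∷ xs) with does (P? x)
... | true  = cong (_+_ 1) (length-filter≡sum-𝟙 P? xs)
... | false = length-filter≡sum-𝟙 P? xs

sum-map-tabulate : ∀ {m} {A : Set} (f : A → ℕ) (g : Fin m → A) →
  List.sum (map f (tabulate g)) ≡ ∑[ i < m ] f (g i)
sum-map-tabulate {zero}  f g = refl
sum-map-tabulate {suc m} f g = cong (_+_ (f (g zero))) (sum-map-tabulate f (g ∘ suc))

count≡∑𝟙 : ∀ {n} {P : Pred (Fin n) 0ℓ} (P? : Decidable P) → count P? ≡ ∑[ j < n ] 𝟙 (P? j)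
count≡∑𝟙 {n} P? = trans (length-filter≡sum-𝟙 P? (tabulate id)) (sum-map-tabulate (𝟙 ∘ P?) id)

∑-const : ∀ n c → ∑[ i < n ] c ≡ n * c
∑-const zero    c = refl
∑-const (suc n) c = cong (_+_ c) (∑-const n c)

∑-zero : ∀ {n} {f : Fin n → ℕ} → (∀ i → f i ≡ 0) → ∑[ i < n ] f i ≡ 0
∑-zero {n} f≗0 = trans (sum-cong-≗ f≗0) (sum-replicate-zero n)

∑-𝟙*-unique : ∀ {n} {P : Pred (Fin n) 0ℓ} (P? : Decidable P) {i} → P i → (∀ {j} → P j → i ≡ j) →
  (g : Fin n → ℕ) → ∑[ j < n ] (𝟙 (P? j) * g j) ≡ g i
∑-𝟙*-unique {suc n} P? {i} Pi unique g = begin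
  ∑[ j < suc n ] (𝟙 (P? j) * g j)
    ≡⟨ sum-remove {i = i} (λ j → 𝟙 (P? j) * g j) ⟩
  𝟙 (P? i) * g i + ∑[ j < n ] (𝟙 (P? (punchIn i j)) * g (punchIn i j))
    ≡⟨ cong₂ _+_ (cong (_* g i) (𝟙-true (P? i) Pi)) (∑-zero λ j →
         cong (_* g (punchIn i j)) (𝟙-false (P? (punchIn i j)) (punchInᵢ≢i i j ∘ sym ∘ unique))) ⟩
  1 * g i + 0
    ≡⟨ trans (ℕ.+-identityʳ _) (ℕ.*-identityˡ (g i)) ⟩
  g i ∎

∑-𝟙-unique : ∀ {n} {P : Pred (Fin n) 0ℓ} (P? : Decidable P) {i} → P i → (∀ {j} → P j → i ≡ j) →
  ∑[ j < n ] 𝟙 (P? j) ≡ 1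
∑-𝟙-unique P? Pi unique =
  trans (sum-cong-≗ (λ j → sym (ℕ.*-identityʳ (𝟙 (P? j))))) (∑-𝟙*-unique P? Pi unique (λ _ → 1))

∑-δ : ∀ {k} (a : Fin k) (g : Fin k → ℕ) → ∑[ b < k ] (𝟙 (a ≟ b) * g b) ≡ g a
∑-δ a = ∑-𝟙*-unique (a ≟_) refl id

least : ∀ {n} {P : Pred (Fin n) 0ℓ} → Decidable P → ∃ P → ∃ λ i → P i × (∀ {j} → P j → i ≤ j)
least {suc n} P? (j , Pj) with P? zero | j
... | yes P0 | _ = zero , P0 , λ _ → z≤n
... | no ¬P0 | zero = contradiction Pj ¬P0
... | no ¬P0 | suc j′ with least (P? ∘ suc) (j′ , Pj)
...   | i , Pi , i≤ = suc i , Pi , λ { {zero} P0 → contradiction P0 ¬P0 ; {suc j} Pj → s≤s (i≤ Pj) }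

greatest : ∀ {n} {P : Pred (Fin n) 0ℓ} → Decidable P → ∃ P → ∃ λ i → P i × (∀ {j} → P j → j ≤ i)
greatest {suc n} P? (j , Pj) with any? (P? ∘ suc) | j
... | no ¬∃P₊ | zero = zero , Pj , λ { {zero} _ → z≤n ; {suc j} Pj → contradiction (j , Pj) ¬∃P₊ }
... | no ¬∃P₊ | suc j′ = contradiction (j′ , Pj) ¬∃P₊
... | yes ∃P₊ | _ with greatest (P? ∘ suc) ∃P₊
...   | i , Pi , ≤i = suc i , Pi , λ { {zero} _ → z≤n ; {suc j} Pj → s≤s (≤i Pj) }

module _ {n k} (f : Fin n → Fin k) {R : Pred (Fin n) 0ℓ} (R? : Decidable R)
         (transversal : ∀ b → ∃! _≡_ λ j → R j × f j ≡ b) where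

  ∑-transversal : (g : Fin k → ℕ) → ∑[ j < n ] (𝟙 (R? j) * g (f j)) ≡ ∑[ b < k ] g b
  ∑-transversal g = begin
    ∑[ j < n ] (𝟙 (R? j) * g (f j))
      ≡⟨ sum-cong-≗ (λ j → cong (𝟙 (R? j) *_) (sym (∑-δ (f j) g))) ⟩
    ∑[ j < n ] (𝟙 (R? j) * ∑[ b < k ] (𝟙 (f j ≟ b) * g b))
      ≡⟨ sum-cong-≗ (λ j → *-distribˡ-sum (𝟙 (R? j)) (λ b → 𝟙 (f j ≟ b) * g b)) ⟩
    ∑[ j < n ] ∑[ b < k ] (𝟙 (R? j) * (𝟙 (f j ≟ b) * g b))
      ≡⟨ sum-cong-≗ (λ j → sum-cong-≗ λ b →
           trans (sym (ℕ.*-assoc (𝟙 (R? j)) (𝟙 (f j ≟ b)) (g b)))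
                 (cong (_* g b) (sym (𝟙-×-dec (R? j) (f j ≟ b))))) ⟩
    ∑[ j < n ] ∑[ b < k ] (𝟙 (R? j ×-dec f j ≟ b) * g b)
      ≡⟨ ∑-comm (λ j b → 𝟙 (R? j ×-dec f j ≟ b) * g b) ⟩
    ∑[ b < k ] ∑[ j < n ] (𝟙 (R? j ×-dec f j ≟ b) * g b)
      ≡⟨ sum-cong-≗ (λ b → let (_ , Rj×fj≡b , unique) = transversal b in
                             ∑-𝟙*-unique (λ j → R? j ×-dec f j ≟ b) Rj×fj≡b unique (λ _ → g b)) ⟩
    ∑[ b < k ] g b ∎

  count-transversal : {Q : Pred (Fin k) 0ℓ} (Q? : Decidable Q) →
                      count (λ j → R? j ×-dec Q? (f j)) ≡ count Q?
  count-transversal Q? = begin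
    count (λ j → R? j ×-dec Q? (f j))            ≡⟨ count≡∑𝟙 (λ j → R? j ×-dec Q? (f j)) ⟩
    ∑[ j < n ] 𝟙 (R? j ×-dec Q? (f j))           ≡⟨ sum-cong-≗ (λ j → 𝟙-×-dec (R? j) (Q? (f j))) ⟩
    ∑[ j < n ] (𝟙 (R? j) * 𝟙 (Q? (f j)))         ≡⟨ ∑-transversal (𝟙 ∘ Q?) ⟩
    ∑[ b < k ] 𝟙 (Q? b)                          ≡⟨ sym (count≡∑𝟙 Q?) ⟩
    count Q?                                     ∎

𝟙-split : ∀ {n} (i j : Fin n) {X Q : Set} (x? : Dec X) (q? : Dec Q) → (Q → i ≢ j) →
  𝟙 (x? ×-dec j <? i ×-dec q?) + 𝟙 (x? ×-dec i <? j ×-dec q?) ≡ 𝟙 (x? ×-dec q?)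
𝟙-split i j (false because _) q? i≢j = refl
𝟙-split i j (true because _) q? i≢j with q? | <-cmp i j
... | no ¬q | _ =
  cong₂ _+_ (𝟙-false (j <? i ×-dec no ¬q) (¬q ∘ proj₂)) (𝟙-false (i <? j ×-dec no ¬q) (¬q ∘ proj₂))
... | yes q | tri< i<j _ _ =
  cong₂ _+_ (𝟙-false (j <? i ×-dec yes q) (<-asym i<j ∘ proj₁)) (𝟙-true (i <? j ×-dec yes q) (i<j , q))
... | yes q | tri≈ _ i≡j _ = contradiction i≡j (i≢j q)
... | yes q | tri> _ _ j<i =
  cong₂ _+_ (𝟙-true (j <? i ×-dec yes q) (j<i , q)) (𝟙-false (i <? j ×-dec yes q) (<-asym j<i ∘ proj₁))

count-split : ∀ {n} (i : Fin n) {X Q : Pred (Fin n) 0ℓ} (X? : Decidable X) (Q? : Decidable Q) →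
  (∀ {j} → Q j → i ≢ j) →
  count (λ j → X? j ×-dec j <? i ×-dec Q? j) + count (λ j → X? j ×-dec i <? j ×-dec Q? j) ≡
  count (λ j → X? j ×-dec Q? j)
count-split {n} i {X} {Q} X? Q? i≢ = begin
  count before? + count after?
    ≡⟨ cong₂ _+_ (count≡∑𝟙 before?) (count≡∑𝟙 after?) ⟩
  ∑[ j < n ] 𝟙 (before? j) + ∑[ j < n ] 𝟙 (after? j)
    ≡⟨ sym (∑-distrib-+ (𝟙 ∘ before?) (𝟙 ∘ after?)) ⟩
  ∑[ j < n ] (𝟙 (before? j) + 𝟙 (after? j))
    ≡⟨ sum-cong-≗ (λ j → 𝟙-split i j (X? j) (Q? j) i≢) ⟩
  ∑[ j < n ] 𝟙 (X? j ×-dec Q? j)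
    ≡⟨ sym (count≡∑𝟙 (λ j → X? j ×-dec Q? j)) ⟩
  count (λ j → X? j ×-dec Q? j) ∎
  where
  before? : Decidable (λ j → X j × j < i × Q j)
  before? j = X? j ×-dec j <? i ×-dec Q? j
  after? : Decidable (λ j → X j × i < j × Q j)
  after? j = X? j ×-dec i <? j ×-dec Q? j

count-above+count-below+1 : ∀ {k} (a : Fin k) →
  count (λ (b : Fin k) → a <? b) + count (λ (b : Fin k) → b <? a) + 1 ≡ k
count-above+count-below+1 {k} a = begin
  count above? + count below? + 1
    ≡⟨ cong₂ _+_ (cong₂ _+_ (count≡∑𝟙 above?) (count≡∑𝟙 below?)) (sym (∑-𝟙-unique (a ≟_) refl id)) ⟩
  ∑[ b < k ] 𝟙 (above? b) + ∑[ b < k ] 𝟙 (below? b) + ∑[ b < k ] 𝟙 (a ≟ b)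
    ≡⟨ cong (_+ ∑[ b < k ] 𝟙 (a ≟ b)) (sym (∑-distrib-+ (𝟙 ∘ above?) (𝟙 ∘ below?))) ⟩
  ∑[ b < k ] (𝟙 (above? b) + 𝟙 (below? b)) + ∑[ b < k ] 𝟙 (a ≟ b)
    ≡⟨ sym (∑-distrib-+ (λ b → 𝟙 (above? b) + 𝟙 (below? b)) (λ b → 𝟙 (a ≟ b))) ⟩
  ∑[ b < k ] (𝟙 (above? b) + 𝟙 (below? b) + 𝟙 (a ≟ b))
    ≡⟨ sum-cong-≗ trichotomy ⟩
  ∑[ b < k ] 1
    ≡⟨ trans (∑-const k 1) (ℕ.*-identityʳ k) ⟩
  k ∎
  where
  above? : Decidable (λ (b : Fin k) → a < b)
  above? b = a <? b
  below? : Decidable (λ (b : Fin k) → b < a)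
  below? b = b <? a
  trichotomy : ∀ b → 𝟙 (above? b) + 𝟙 (below? b) + 𝟙 (a ≟ b) ≡ 1
  trichotomy b with <-cmp a b
  ... | tri< a<b a≢b _ =
    cong₂ _+_ (cong₂ _+_ (𝟙-true (a <? b) a<b) (𝟙-false (b <? a) (<-asym a<b))) (𝟙-false (a ≟ b) a≢b)
  ... | tri≈ _ a≡b _ =
    cong₂ _+_ (cong₂ _+_ (𝟙-false (a <? b) (<-irrefl a≡b)) (𝟙-false (b <? a) (<-irrefl (sym a≡b))))
              (𝟙-true (a ≟ b) a≡b)
  ... | tri> _ a≢b b<a =
    cong₂ _+_ (cong₂ _+_ (𝟙-false (a <? b) (<-asym b<a)) (𝟙-true (b <? a) b<a)) (𝟙-false (a ≟ b) a≢b)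

count-above+count-below : ∀ {k} (a : Fin k) →
  count (λ (b : Fin k) → a <? b) + count (λ (b : Fin k) → b <? a) ≡ k ∸ 1
count-above+count-below {k} a = begin
  count (λ (b : Fin k) → a <? b) + count (λ (b : Fin k) → b <? a)
    ≡⟨ sym (ℕ.m+n∸n≡m _ 1) ⟩
  count (λ (b : Fin k) → a <? b) + count (λ (b : Fin k) → b <? a) + 1 ∸ 1
    ≡⟨ cong (_∸ 1) (count-above+count-below+1 a) ⟩
  k ∸ 1 ∎

module _ {n k} (π : SetPartition n k) where

  block-inhabited : ∀ b → ∃ λ j → w π j ≡ b
  block-inhabited b = let (j , wj≡b) = nonempty π b in j , wj≡b refl

  openers-transversal : ∀ b → ∃! _≡_ λ j → IsOpener π j × w π j ≡ b
  openers-transversal b =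
    let (i , wi≡b , i≤) = least (λ j → w π j ≟ b) (block-inhabited b) in
    i , ((λ j wj≡wi → i≤ (trans wj≡wi wi≡b)) , wi≡b) ,
    λ (opener , wj≡b) → ≤-antisym (i≤ wj≡b) (opener i (trans wi≡b (sym wj≡b)))

  closers-transversal : ∀ b → ∃! _≡_ λ j → IsCloser π j × w π j ≡ b
  closers-transversal b =
    let (i , wi≡b , ≤i) = greatest (λ j → w π j ≟ b) (block-inhabited b) in
    i , ((λ j wj≡wi → ≤i (trans wj≡wi wi≡b)) , wi≡b) ,
    λ (closer , wj≡b) → ≤-antisym (closer i (trans wi≡b (sym wj≡b))) (≤i wj≡b)

  module _ {R : Pred (Fin n) 0ℓ} (R? : Decidable R)
           (R-transversal : ∀ b → ∃! _≡_ λ j → R j × w π j ≡ b) (i : Fin n) where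

    count-split-above : count (λ j → R? j ×-dec j <? i ×-dec w π i <? w π j) +
                        count (λ j → R? j ×-dec i <? j ×-dec w π i <? w π j) ≡
                        count (λ (b : Fin k) → w π i <? b)
    count-split-above =
      trans (count-split i R? (λ j → w π i <? w π j) (λ wi<wj i≡j → <-irrefl (cong (w π) i≡j) wi<wj))
            (count-transversal (w π) R? R-transversal (λ (b : Fin k) → w π i <? b))

    count-split-below : count (λ j → R? j ×-dec j <? i ×-dec w π j <? w π i) +
                        count (λ j → R? j ×-dec i <? j ×-dec w π j <? w π i) ≡
                        count (λ (b : Fin k) → b <? w π i)
    count-split-below =
      trans (count-split i R? (λ j → w π j <? w π i) (λ wj<wi i≡j → <-irrefl (cong (w π) (sym i≡j)) wj<wi))
            (count-transversal (w π) R? R-transversal (λ (b : Fin k) → b <? w π i))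

  ros+lcs+[lcb+rob]≡k∸1 : ∀ i → ros-i π i + lcs-i π i + (lcb-i π i + rob-i π i) ≡ k ∸ 1
  ros+lcs+[lcb+rob]≡k∸1 i = begin
    ros-i π i + lcs-i π i + (lcb-i π i + rob-i π i)
      ≡⟨ cong (_+_ (ros-i π i + lcs-i π i)) (ℕ.+-comm (lcb-i π i) (rob-i π i)) ⟩
    ros-i π i + lcs-i π i + (rob-i π i + lcb-i π i)
      ≡⟨ interchange (ros-i π i) (lcs-i π i) (rob-i π i) (lcb-i π i) ⟩
    (ros-i π i + rob-i π i) + (lcs-i π i + lcb-i π i)
      ≡⟨ cong₂ _+_ (count-split-above (isOpener? π) openers-transversal i)
                   (count-split-below (isCloser? π) closers-transversal i) ⟩
    count (λ (b : Fin k) → w π i <? b) + count (λ (b : Fin k) → b <? w π i)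
      ≡⟨ count-above+count-below (w π i) ⟩
    k ∸ 1 ∎

  lob+rcb+[los+rcs]≡k∸1 : ∀ i → lob-i π i + rcb-i π i + (los-i π i + rcs-i π i) ≡ k ∸ 1
  lob+rcb+[los+rcs]≡k∸1 i = begin
    lob-i π i + rcb-i π i + (los-i π i + rcs-i π i)
      ≡⟨ ℕ.+-comm (lob-i π i + rcb-i π i) (los-i π i + rcs-i π i) ⟩
    los-i π i + rcs-i π i + (lob-i π i + rcb-i π i)
      ≡⟨ interchange (los-i π i) (rcs-i π i) (lob-i π i) (rcb-i π i) ⟩
    (los-i π i + lob-i π i) + (rcs-i π i + rcb-i π i)
      ≡⟨ cong₂ _+_ (count-split-below (isOpener? π) openers-transversal i)
                   (count-split-above (isCloser? π) closers-transversal i) ⟩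
    count (λ (b : Fin k) → b <? w π i) + count (λ (b : Fin k) → w π i <? b)
      ≡⟨ ℕ.+-comm (count (λ (b : Fin k) → b <? w π i)) (count (λ (b : Fin k) → w π i <? b)) ⟩
    count (λ (b : Fin k) → w π i <? b) + count (λ (b : Fin k) → b <? w π i)
      ≡⟨ count-above+count-below (w π i) ⟩
    k ∸ 1 ∎

  Σᵢ≡∑ : (f : Fin n → ℕ) → Σᵢ π f ≡ ∑[ i < n ] f i
  Σᵢ≡∑ f = sum-map-tabulate f id

  Σᵢ-pointwise-constant : {a b c d : Fin n → ℕ} {m : ℕ} → (∀ i → a i + b i + (c i + d i) ≡ m) →
    Σᵢ π a + Σᵢ π b + (Σᵢ π c + Σᵢ π d) ≡ n * m
  Σᵢ-pointwise-constant {a} {b} {c} {d} {m} rows = begin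
    Σᵢ π a + Σᵢ π b + (Σᵢ π c + Σᵢ π d)
      ≡⟨ cong₂ _+_ (cong₂ _+_ (Σᵢ≡∑ a) (Σᵢ≡∑ b)) (cong₂ _+_ (Σᵢ≡∑ c) (Σᵢ≡∑ d)) ⟩
    ∑[ i < n ] a i + ∑[ i < n ] b i + (∑[ i < n ] c i + ∑[ i < n ] d i)
      ≡⟨ sym (cong₂ _+_ (∑-distrib-+ a b) (∑-distrib-+ c d)) ⟩
    ∑[ i < n ] (a i + b i) + ∑[ i < n ] (c i + d i)
      ≡⟨ sym (∑-distrib-+ (λ i → a i + b i) (λ i → c i + d i)) ⟩
    ∑[ i < n ] (a i + b i + (c i + d i))
      ≡⟨ sum-cong-≗ rows ⟩
    ∑[ i < n ] m
      ≡⟨ ∑-const n m ⟩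
    n * m ∎

m+n≡o⇒+m≡+o-+n : ∀ {m n o} → m + n ≡ o → + m ≡ + o ℤ.- + n
m+n≡o⇒+m≡+o-+n {m} {n} refl = sym (begin
  + (m + n) ℤ.- + n  ≡⟨ [+m]-[+n]≡m⊖n (m + n) n ⟩
  (m + n) ℤ.⊖ n      ≡⟨ ⊖-≥ (ℕ.m≤n+m n m) ⟩
  + (m + n ∸ n)      ≡⟨ cong +_ (ℕ.m+n∸n≡m m n) ⟩
  + m                ∎)

mainTheorem3 : (n k : ℕ) → n ≥ 1 → k ≥ 1 → (π : SetPartition n k) →
    (+ (mak π) ≡ lmak′ π) × (+ (mak′ π) ≡ lmak π)
mainTheorem3 n k _ _ π =
  m+n≡o⇒+m≡+o-+n (Σᵢ-pointwise-constant π (ros+lcs+[lcb+rob]≡k∸1 π)) ,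
  m+n≡o⇒+m≡+o-+n (Σᵢ-pointwise-constant π (lob+rcb+[los+rcs]≡k∸1 π))
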